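{- Let $\mathcal E$ be a category and $\mathcal F\subseteq\mathcal E$ a subcategory with the same objects, and assume $\mathcal F$ is a countable projective Fra\"iss\'e category. Let $g\in\mathcal E$. Then $g$ belongs to the domination closure $[\mathcal F]$ of $\mathcal F$ in $\mathcal E$ if and only if there exists an $\mathcal E$-iso-sequence $(g_i)$ for $\mathcal F$ with $g_0=g$.
   Context: Projective Fra\"iss\'e category: essentially countable category (objects countable up to isomorphism, countably many morphisms between any two objects) with joint projection (for objects $o_1,o_2$ there are $e_1,e_2$ with $\mathrm{codom}(e_i)=o_i$ and common domain) and projective amalgamation (for $e_1,e_2$ with common codomain there are $e_1',e_2'$ with $e_1\circ e_1'=e_2\circ e_2'$). $\mathcal F$ is dominating in a set $X$ of morphisms if $g\circ f\in X$ for all composable $f\in\mathcal F$, $g\in X$, and for each $g'\in X$ there is $g''\in X$ with $g'\circ g''\in\mathcal F$; $[\mathcal F]$ is the union of all $X\subseteq\mathcal E$ in which $\mathcal F$ is dominating. A sequence $(e_n)$ is neat if $\mathrm{dom}(e_n)=\mathrm{codom}(e_{n+1})$; a neat sequence in $\mathcal F$ is generic for $\mathcal F$ if every object $o$ is the codomain of some $e\in\mathcal F$ with $\mathrm{dom}(e)=\mathrm{dom}(e_n)$ for some $n$, and for every $n$ and $e\in\mathcal F$ with $\mathrm{codom}(e)=\mathrm{codom}(e_n)$ there are $m>n$, $e'\in\mathcal F$ with $e_n\circ\dots\circ e_m=e\circ e'$. An $\mathcal E$-iso-sequence for $\mathcal F$ is a neat sequence $(g_i)$ of morphisms of $\mathcal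 E$ such that both $(g_{2i}\circ g_{2i+1})_i$ and $(g_{2i+1}\circ g_{2i+2})_i$ are generic sequences for $\mathcal F$. -}

module Defs where

open import Data.Nat using (ℕ; zero; suc; _+_)
open import Data.Maybe using (Maybe; just)
open import Data.Product using (Σ; Σ-syntax; ∃; ∃-syntax; _×_; _,_)
open import Relation.Binary.PropositionalEquality using (_≡_)

record Category : Set₁ where
  infixr 9 _∘_
  field
    Obj  : Set
    Hom  : Obj → Obj → Set
    id   : ∀ {A} → Hom A A
    _∘_  : ∀ {A B C} → Hom B C → Hom A B → Hom A C
    assoc : ∀ {A B C D} (h : Hom C D) (g : Hom B C) (f : Hom A B) →
            (h ∘ g) ∘ f ≡ h ∘ (g ∘ f)
    identityˡ : ∀ {A B} (f : Hom A B) → id ∘ f ≡ f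
    identityʳ : ∀ {A B} (f : Hom A B) → f ∘ id ≡ f

record Subcategory (𝓔 : Category) : Set₁ where
  open Category 𝓔
  field
    In      : ∀ {A B} → Hom A B → Set
    id-In   : ∀ {A} → In (id {A})
    ∘-In    : ∀ {A B C} {g : Hom B C} {f : Hom A B} → In g → In f → In (g ∘ f)

module _ {𝓔 : Category} (𝓕 : Subcategory 𝓔) where
  open Category 𝓔
  open Subcategory 𝓕

  IsoIn : Obj → Obj → Set
  IsoIn A B = Σ[ f ∈ Hom A B ] Σ[ f⁻ ∈ Hom B A ]
              (In f × In f⁻ × (f ∘ f⁻ ≡ id) × (f⁻ ∘ f ≡ id))

  -- countably many 𝓕-morphisms between any two objects
  -- (a surjection ℕ → Maybe (morphisms), allowing the empty case)
  CountableHoms : Set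
  CountableHoms = ∀ A B → Σ[ s ∈ (ℕ → Maybe (Σ[ f ∈ Hom A B ] In f)) ]
                    (∀ (x : Σ[ f ∈ Hom A B ] In f) → ∃[ n ] s n ≡ just x)

  CountableObjs : Set
  CountableObjs = Σ[ o ∈ (ℕ → Maybe Obj) ]
                    (∀ A → Σ[ n ∈ ℕ ] Σ[ B ∈ Obj ] (o n ≡ just B × IsoIn A B))

  EssentiallyCountable : Set
  EssentiallyCountable = CountableObjs × CountableHoms

  JointProjection : Set
  JointProjection = ∀ (o₁ o₂ : Obj) →
    Σ[ D ∈ Obj ] Σ[ e₁ ∈ Hom D o₁ ] Σ[ e₂ ∈ Hom D o₂ ] (In e₁ × In e₂)

  ProjectiveAmalgamation : Set
  ProjectiveAmalgamation = ∀ {A B C} (e₁ : Hom A C) (e₂ : Hom B C) →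
    In e₁ → In e₂ →
    Σ[ D ∈ Obj ] Σ[ e₁' ∈ Hom D A ] Σ[ e₂' ∈ Hom D B ]
      (In e₁' × In e₂' × (e₁ ∘ e₁' ≡ e₂ ∘ e₂'))

  record ProjectiveFraisse : Set where
    field
      countable     : EssentiallyCountable
      jointProj     : JointProjection
      amalgamation  : ProjectiveAmalgamation

  MorSet : Set₁
  MorSet = ∀ {A B} → Hom A B → Set

  Dominating : MorSet → Set
  Dominating X =
    (∀ {A B C} (f : Hom A B) (g : Hom B C) → In f → X g → X (g ∘ f)) ×
    (∀ {B C} (g' : Hom B C) → X g' →
       Σ[ A ∈ Obj ] Σ[ g'' ∈ Hom A B ] (X g'' × In (g' ∘ g'')))

  InClosure : ∀ {A B} → Hom A B → Set₁
  InClosure g = Σ[ X ∈ MorSet ] (Dominating X × X g)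

  -- Neat sequences: objects o n and morphisms e n : o (n+1) → o n,
  -- so dom (e n) = codom (e (n+1)).

  chain : (o : ℕ → Obj) (e : ∀ n → Hom (o (suc n)) (o n)) →
          (n k : ℕ) → Hom (o (suc (k + n))) (o n)
  chain o e n zero    = e n
  chain o e n (suc k) = chain o e n k ∘ e (suc (k + n))

  Generic : (o : ℕ → Obj) (e : ∀ n → Hom (o (suc n)) (o n)) → Set
  Generic o e =
    (∀ n → In (e n)) ×
    (∀ (c : Obj) → Σ[ n ∈ ℕ ] Σ[ f ∈ Hom (o (suc n)) c ] In f) ×
    (∀ n {D} (f : Hom D (o n)) → In f →
       -- some m = (suc k) + n > n with e n ∘ ... ∘ e m = f ∘ f'
       Σ[ k ∈ ℕ ] Σ[ f' ∈ Hom (o (suc (suc k + n))) D ]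
         (In f' × chain o e n (suc k) ≡ f ∘ f'))

  double : ℕ → ℕ
  double zero    = zero
  double (suc i) = suc (suc (double i))

  evenObj : (ℕ → Obj) → ℕ → Obj
  evenObj o i = o (double i)

  oddObj : (ℕ → Obj) → ℕ → Obj
  oddObj o i = o (suc (double i))

  evenSeq : (o : ℕ → Obj) (g : ∀ n → Hom (o (suc n)) (o n)) →
            ∀ i → Hom (evenObj o (suc i)) (evenObj o i)
  evenSeq o g i = g (double i) ∘ g (suc (double i))

  oddSeq : (o : ℕ → Obj) (g : ∀ n → Hom (o (suc n)) (o n)) →
           ∀ i → Hom (oddObj o (suc i)) (oddObj o i)
  oddSeq o g i = g (suc (double i)) ∘ g (suc (suc (double i)))

  IsoSequence : (o : ℕ → Obj) (g : ∀ n → Hom (o (suc n)) (o n)) → Set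
  IsoSequence o g = Generic (evenObj o) (evenSeq o g) ×
                    Generic (oddObj o) (oddSeq o g)

  Arrow : Set
  Arrow = Σ[ A ∈ Obj ] Σ[ B ∈ Obj ] Hom A B

  HasIsoSequenceFrom : ∀ {A B} → Hom A B → Set
  HasIsoSequenceFrom {A} {B} g =
    Σ[ o ∈ (ℕ → Obj) ] Σ[ s ∈ (∀ n → Hom (o (suc n)) (o n)) ]
      (IsoSequence o s × (_≡_ {A = Arrow} (o 1 , o 0 , s 0) (A , B , g)))

module Submission where

-- (⇐) Given an iso-sequence (s n), the set of 𝓕-sandwiches a ∘ s n ∘ b
-- (a, b ∈ 𝓕) is a set in which 𝓕 is dominating and which contains s 0 = g.
-- The only real work is "closing": s n ∘ b ∘ b' ∘ s M ∈ 𝓕 for suitable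
-- b' ∈ 𝓕, obtained from genericity of the pair sequence through the domain of
-- s n.  It is proved for n = 0 and transported to all n by shifting the
-- sequence, which swaps the roles of its two pair sequences.
--
-- (⇒) Given X ∋ g with 𝓕 dominating in X, we build s 0 = g, s 1, … in X one
-- term at a time.  Each step uses domination, amalgamation and joint
-- projection once ('extend') to make the new pair s l ∘ s (l+1) lie in 𝓕,
-- factor through one pending requirement (an 𝓕-map into o l) and map onto
-- one enumerated object.  Requirements are labelled by pairs (n , c), pulled
-- back along every new pair by amalgamation, and handled following a
-- diagonal enumeration of labels.  'bookkeeping⇒generic' shows abstractly
-- that such a schedule makes a sequence generic.

open import Defs
open import Data.Product using (Σ; Σ-syntax; ∃-syntax; _×_; _,_; proj₁; proj₂)
open import Data.Nat using (ℕ; zero; suc; _+_; _≤_; _≟_)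
open import Data.Nat.Properties using (+-suc; +-identityʳ; m≤n+m; 1+n≰n)
open import Data.Maybe using (Maybe; just; fromMaybe; _>>=_)
import Data.Maybe as Maybe
open import Relation.Nullary using (yes; no; contradiction)
open import Relation.Binary.PropositionalEquality
  using (_≡_; refl; sym; trans; cong; subst; module ≡-Reasoning)

-- A diagonal enumeration of ℕ × ℕ in which the label (n , c) is reached at a
-- stage d + n ≥ n; it both enumerates countable data and schedules tasks.
next : ℕ × ℕ → ℕ × ℕ
next (n , zero)  = (zero , suc n)
next (n , suc c) = (suc n , c)

unpair : ℕ → ℕ × ℕ
unpair zero    = (0 , 0)
unpair (suc m) = next (unpair m)

unpair-hits : ∀ n c → ∃[ d ] unpair (d + n) ≡ (n , c)
unpair-hits n c = along-diagonal (n + c) n c refl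
  where
  along-diagonal : ∀ t n c → n + c ≡ t → ∃[ d ] unpair (d + n) ≡ (n , c)
  along-diagonal zero zero zero refl = 0 , refl
  along-diagonal (suc t) zero (suc c) refl with along-diagonal t c zero (+-identityʳ c)
  ... | d , reached = suc (d + c) , trans (cong unpair (+-identityʳ (suc (d + c)))) (cong next reached)
  along-diagonal t (suc n) c n+c≡t with along-diagonal t n (suc c) (trans (+-suc n c) n+c≡t)
  ... | d , reached = d , trans (cong unpair (+-suc d n)) (cong next reached)

module _ {𝓔 : Category} (𝓕 : Subcategory 𝓔) where
  open Category 𝓔
  open Subcategory 𝓕

  -- k ≼ h : k factors as h ∘ b with b ∈ 𝓕.  Genericity says exactly that
  -- some chain of the sequence satisfies chain ≼ f.
  infix 4 _≼_
  _≼_ : ∀ {A D B} → Hom A B → Hom D B → Set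
  _≼_ {A} {D} k h = Σ[ b ∈ Hom A D ] (In b × k ≡ h ∘ b)

  ≼-In : ∀ {A D B} {k : Hom A B} {h : Hom D B} → k ≼ h → In h → In k
  ≼-In (b , b∈ , k≡hb) h∈ = subst In (sym k≡hb) (∘-In h∈ b∈)

  ≼-trans : ∀ {A D D' B} {k : Hom A B} {h : Hom D B} {f : Hom D' B} → k ≼ h → h ≼ f → k ≼ f
  ≼-trans {k = k} {h} {f} (b , b∈ , k≡hb) (b' , b'∈ , h≡fb') =
    b' ∘ b , ∘-In b'∈ b∈ , trans k≡hb (trans (cong (_∘ b) h≡fb') (assoc f b' b))

  ≼-∘ʳ : ∀ {A A' D B} {k : Hom A B} {h : Hom D B} (m : Hom A' A) → In m → k ≼ h → k ∘ m ≼ h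
  ≼-∘ʳ {k = k} {h} m m∈ (b , b∈ , k≡hb) =
    b ∘ m , ∘-In b∈ m∈ , trans (cong (_∘ m) k≡hb) (assoc h b m)

  ≼-∘ˡ : ∀ {A D B C} {k : Hom A B} {h : Hom D B} (t : Hom B C) → k ≼ h → t ∘ k ≼ t ∘ h
  ≼-∘ˡ {k = k} {h} t (b , b∈ , k≡hb) =
    b , b∈ , trans (cong (t ∘_) k≡hb) (sym (assoc t h b))

  ≼-transport : ∀ (E : ℕ → Obj) {B D} {f : Hom D B} {m m'} {h : Hom (E m) B} {h' : Hom (E m') B} →
    _≡_ {A = Σ ℕ λ m → Hom (E m) B} (m , h) (m' , h') → h ≼ f → h' ≼ f
  ≼-transport E refl h≼f = h≼f

  chain-shift : ∀ (E : ℕ → Obj) (e : ∀ n → Hom (E (suc n)) (E n)) n k →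
    _≡_ {A = Σ ℕ λ m → Hom (E m) (E (suc n))}
        (suc (k + suc n) , chain 𝓕 E e (suc n) k)
        (suc (suc (k + n)) , chain 𝓕 (λ i → E (suc i)) (λ i → e (suc i)) n k)
  chain-shift E e n zero    = refl
  chain-shift E e n (suc k) = cong (λ { (m , h) → suc m , h ∘ e m }) (chain-shift E e n k)

  generic-tail : ∀ {E : ℕ → Obj} {e : ∀ n → Hom (E (suc n)) (E n)} →
    Generic 𝓕 E e → Generic 𝓕 (λ n → E (suc n)) (λ n → e (suc n))
  generic-tail {E} {e} (e∈ , onto , factor) = (λ n → e∈ (suc n)) , onto' , factor'
    where
    onto' : ∀ c → Σ[ n ∈ ℕ ] Σ[ f ∈ Hom (E (suc (suc n))) c ] In f
    onto' c with onto c
    ... | n , f , f∈ = n , f ∘ e (suc n) , ∘-In f∈ (e∈ (suc n))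
    factor' : ∀ n {D} (f : Hom D (E (suc n))) → In f →
      Σ[ k ∈ ℕ ] (chain 𝓕 (λ i → E (suc i)) (λ i → e (suc i)) n (suc k) ≼ f)
    factor' n f f∈ with factor (suc n) f f∈
    ... | k , chain≼f = k , ≼-transport E (chain-shift E e n (suc k)) chain≼f

  iso-shift : ∀ {o : ℕ → Obj} {s : ∀ n → Hom (o (suc n)) (o n)} →
    IsoSequence 𝓕 o s → IsoSequence 𝓕 (λ n → o (suc n)) (λ n → s (suc n))
  iso-shift (even , odd) = odd , generic-tail even

  reassoc : ∀ {A B C D E F} (a : Hom E F) (c : Hom D E) (u : Hom C D) (v : Hom B C) (w : Hom A B) →
    a ∘ ((c ∘ (u ∘ v)) ∘ w) ≡ (a ∘ (c ∘ u)) ∘ (v ∘ w)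
  reassoc a c u v w = begin
    a ∘ ((c ∘ (u ∘ v)) ∘ w)  ≡⟨ cong (a ∘_) (assoc c (u ∘ v) w) ⟩
    a ∘ (c ∘ ((u ∘ v) ∘ w))  ≡⟨ cong (λ z → a ∘ (c ∘ z)) (assoc u v w) ⟩
    a ∘ (c ∘ (u ∘ (v ∘ w)))  ≡⟨ cong (a ∘_) (sym (assoc c u (v ∘ w))) ⟩
    a ∘ ((c ∘ u) ∘ (v ∘ w))  ≡⟨ sym (assoc a (c ∘ u) (v ∘ w)) ⟩
    (a ∘ (c ∘ u)) ∘ (v ∘ w)  ∎
    where open ≡-Reasoning

  -- Framing an odd chain by its two neighbouring terms gives a composite of
  -- consecutive even pairs, hence a map of 𝓕.
  framed-odd-chain : ∀ (o : ℕ → Obj) (s : ∀ n → Hom (o (suc n)) (o n)) →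
    (∀ i → In (evenSeq 𝓕 o s i)) →
    ∀ k → In (s 0 ∘ (chain 𝓕 (oddObj 𝓕 o) (oddSeq 𝓕 o s) 0 k ∘ s (suc (double 𝓕 (suc (k + 0))))))
  framed-odd-chain o s pairs∈ zero =
    subst In (sym (trans (cong (s 0 ∘_) (assoc (s 1) (s 2) (s 3))) (sym (assoc (s 0) (s 1) (s 2 ∘ s 3)))))
          (∘-In (pairs∈ 0) (pairs∈ 1))
  framed-odd-chain o s pairs∈ (suc k) =
    subst In (sym (reassoc _ _ _ _ _)) (∘-In (framed-odd-chain o s pairs∈ k) (pairs∈ (suc (suc (k + 0)))))

  closing : ∀ (o : ℕ → Obj) (s : ∀ n → Hom (o (suc n)) (o n)) → IsoSequence 𝓕 o s →
    ∀ n {D} (b : Hom D (o (suc n))) → In b →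
    Σ[ M ∈ ℕ ] Σ[ b' ∈ Hom (o M) D ] (In b' × In (s n ∘ (b ∘ (b' ∘ s M))))
  closing o s ((pairs∈ , _) , (_ , _ , odd-factor)) zero b b∈ with odd-factor 0 b b∈
  ... | k , b' , b'∈ , chain≡bb' =
    _ , b' , b'∈ ,
    subst In (cong (s 0 ∘_) (trans (cong (_∘ s _) chain≡bb') (assoc b b' _)))
             (framed-odd-chain o s pairs∈ (suc k))
  closing o s iso (suc n) b b∈ with closing (λ i → o (suc i)) (λ i → s (suc i)) (iso-shift {o} {s} iso) n b b∈
  ... | M , b' , b'∈ , closed = suc M , b' , b'∈ , closed

  module Backward (o : ℕ → Obj) (s : ∀ n → Hom (o (suc n)) (o n)) (iso : IsoSequence 𝓕 o s) where

    Sandwich : MorSet 𝓕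
    Sandwich {A} {B} h =
      Σ[ n ∈ ℕ ] Σ[ a ∈ Hom (o n) B ] Σ[ b ∈ Hom A (o (suc n)) ] (In a × In b × h ≡ a ∘ (s n ∘ b))

    sandwich-dominated : Dominating 𝓕 Sandwich
    sandwich-dominated = precompose , close
      where
      precompose : ∀ {A B C} (f : Hom A B) (h : Hom B C) → In f → Sandwich h → Sandwich (h ∘ f)
      precompose f h f∈ (n , a , b , a∈ , b∈ , h≡asb) =
        n , a , b ∘ f , a∈ , ∘-In b∈ f∈ ,
        trans (cong (_∘ f) h≡asb) (trans (assoc a (s n ∘ b) f) (cong (a ∘_) (assoc (s n) b f)))
      close : ∀ {B C} (h : Hom B C) → Sandwich h →
        Σ[ A ∈ Obj ] Σ[ h' ∈ Hom A B ] (Sandwich h' × In (h ∘ h'))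
      close h (n , a , b , a∈ , b∈ , h≡asb) with closing o s iso n b b∈
      ... | M , b' , b'∈ , closed =
        o (suc M) , b' ∘ (s M ∘ id) , (M , b' , id , b'∈ , id-In , refl) ,
        subst In (sym composite) (∘-In a∈ closed)
        where
        open ≡-Reasoning
        composite : h ∘ (b' ∘ (s M ∘ id)) ≡ a ∘ (s n ∘ (b ∘ (b' ∘ s M)))
        composite = begin
          h ∘ (b' ∘ (s M ∘ id))          ≡⟨ cong (λ z → h ∘ (b' ∘ z)) (identityʳ (s M)) ⟩
          h ∘ (b' ∘ s M)                 ≡⟨ cong (_∘ (b' ∘ s M)) h≡asb ⟩
          (a ∘ (s n ∘ b)) ∘ (b' ∘ s M)   ≡⟨ assoc a (s n ∘ b) (b' ∘ s M) ⟩
          a ∘ ((s n ∘ b) ∘ (b' ∘ s M))   ≡⟨ cong (a ∘_) (assoc (s n) b (b' ∘ s M)) ⟩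
          a ∘ (s n ∘ (b ∘ (b' ∘ s M)))   ∎

  backward : ∀ {A B} (g : Hom A B) → HasIsoSequenceFrom 𝓕 g → InClosure 𝓕 g
  backward g (o , s , iso , refl) =
    Sandwich , sandwich-dominated , (0 , id , id , id-In , id-In , sym (trans (identityˡ _) (identityʳ _)))
    where open Backward o s iso

  -- a requirement at Z: an 𝓕-map into Z that the sequence must factor through
  Req : Obj → Set
  Req Z = Σ[ D ∈ Obj ] Σ[ h ∈ Hom D Z ] In h

  req : ∀ {Z} (r : Req Z) → Hom (proj₁ r) Z
  req r = proj₁ (proj₂ r)

  -- id: satisfied by anything, used where an enumeration has a gap
  trivialReq : ∀ Z → Req Z
  trivialReq Z = Z , id , id-In

  Table : Obj → Set
  Table Z = ℕ × ℕ → Req Z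

  record Bookkeeping (E : ℕ → Obj) (e : ∀ i → Hom (E (suc i)) (E i)) : Set where
    field
      table   : ∀ i → Table (E i)
      fresh   : ∀ i {D} (f : Hom D (E i)) → In f → ∃[ c ] (req (table i (i , c)) ≼ f)
      pulled  : ∀ i n c → n ≤ i → e i ∘ req (table (suc i) (n , c)) ≼ req (table i (n , c))
      handled : ∀ i → e i ≼ req (table i (unpair i))

  chain-through-pulled : ∀ (E : ℕ → Obj) (e : ∀ i → Hom (E (suc i)) (E i)) n
    (r : ∀ k → Req (E (k + n))) →
    (∀ k → e (k + n) ∘ req (r (suc k)) ≼ req (r k)) →
    ∀ d {A} (u : Hom A (E (suc (d + n)))) → u ≼ req (r (suc d)) → chain 𝓕 E e n d ∘ u ≼ req (r 0)
  chain-through-pulled E e n r pulled zero u u≼ = ≼-trans (≼-∘ˡ (e n) u≼) (pulled 0)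
  chain-through-pulled E e n r pulled (suc d) u u≼ =
    subst (_≼ req (r 0)) (sym (assoc (chain 𝓕 E e n d) (e (suc (d + n))) u))
      (chain-through-pulled E e n r pulled d (e (suc (d + n)) ∘ u)
        (≼-trans (≼-∘ˡ (e (suc (d + n))) u≼) (pulled (suc d))))

  -- A schedule makes a sequence of 𝓕-maps onto all objects generic: a map
  -- f ∈ 𝓕 into E n refines a fresh label (n , c), which is handled at some
  -- stage d + n and pulled back along all stages in between.
  bookkeeping⇒generic : ∀ (E : ℕ → Obj) (e : ∀ i → Hom (E (suc i)) (E i)) →
    (∀ i → In (e i)) → (∀ c → Σ[ n ∈ ℕ ] Σ[ f ∈ Hom (E (suc n)) c ] In f) →
    Bookkeeping E e → Generic 𝓕 E e
  bookkeeping⇒generic E e e∈ onto book = e∈ , onto , factor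
    where
    open Bookkeeping book
    handled-label : ∀ m {n c} → unpair m ≡ (n , c) → e m ≼ req (table m (n , c))
    handled-label m reached = subst (λ l → e m ≼ req (table m l)) reached (handled m)

    factor : ∀ n {D} (f : Hom D (E n)) → In f → Σ[ k ∈ ℕ ] (chain 𝓕 E e n (suc k) ≼ f)
    factor n f f∈ with fresh n f f∈
    ... | c , r≼f with unpair-hits n c
    ... | zero , reached =
      0 , ≼-trans (≼-∘ʳ (e (suc n)) (e∈ (suc n)) (handled-label n reached)) r≼f
    ... | suc d , reached =
      d , ≼-trans (chain-through-pulled E e n (λ k → table (k + n) (n , c))
                     (λ k → pulled (k + n) n c (m≤n+m n k))
                     d (e (suc (d + n))) (handled-label (suc (d + n)) reached))
                  r≼f

  module Forward (PF : ProjectiveFraisse 𝓕) (X : MorSet 𝓕) (X-dom : Dominating 𝓕 X) where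
    open ProjectiveFraisse PF

    objEnum : ℕ → Maybe Obj
    objEnum = proj₁ (proj₁ countable)

    objEnum-onto : ∀ A → Σ[ n ∈ ℕ ] Σ[ B ∈ Obj ] (objEnum n ≡ just B × IsoIn 𝓕 A B)
    objEnum-onto = proj₂ (proj₁ countable)

    homEnum : ∀ A B → ℕ → Maybe (Σ[ f ∈ Hom A B ] In f)
    homEnum A B = proj₁ (proj₂ countable A B)

    enumReq : ∀ W → ℕ → Req W
    enumReq W c = fromMaybe (trivialReq W) (candidate (unpair c))
      where
      candidate : ℕ × ℕ → Maybe (Req W)
      candidate (t , r) = objEnum t >>= λ B → Maybe.map (λ { (h , h∈) → B , h , h∈ }) (homEnum B W r)

    -- up to an 𝓕-isomorphism of domains, every 𝓕-map into W is enumerated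
    enumReq-covers : ∀ W {D} (f : Hom D W) → In f → ∃[ c ] (req (enumReq W c) ≼ f)
    enumReq-covers W {D} f f∈ with objEnum-onto D
    ... | t , B , B-listed , φ , φ⁻ , _ , φ⁻∈ , _
        with proj₂ (proj₂ countable B W) (f ∘ φ⁻ , ∘-In f∈ φ⁻∈)
    ... | r , fφ⁻-listed with unpair-hits t r
    ... | d , reached = d + t , subst (λ q → req q ≼ f) (sym listed) (φ⁻ , φ⁻∈ , refl)
      where
      listed : enumReq W (d + t) ≡ (B , f ∘ φ⁻ , ∘-In f∈ φ⁻∈)
      listed rewrite reached | B-listed | fφ⁻-listed = refl

    pullback : ∀ {W Z} (t : Hom W Z) → In t → Req Z → Req W
    pullback t t∈ (D , h , h∈) with amalgamation t h t∈ h∈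
    ... | D' , a , _ , a∈ , _ = D' , a , a∈

    pullback-≼ : ∀ {W Z} (t : Hom W Z) (t∈ : In t) (r : Req Z) → t ∘ req (pullback t t∈ r) ≼ req r
    pullback-≼ t t∈ (D , h , h∈) with amalgamation t h t∈ h∈
    ... | D' , a , b , a∈ , b∈ , ta≡hb = b , b∈ , ta≡hb

    advance : ∀ {W Z} (t : Hom W Z) → In t → Table Z → ℕ → Table W
    advance {W} t t∈ T p (n , c) with n ≟ p
    ... | yes _ = enumReq W c
    ... | no  _ = pullback t t∈ (T (n , c))

    advance-fresh : ∀ {W Z} (t : Hom W Z) (t∈ : In t) T p c → advance t t∈ T p (p , c) ≡ enumReq W c
    advance-fresh t t∈ T p c with p ≟ p
    ... | yes _   = refl
    ... | no p≢p = contradiction refl p≢p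

    advance-old : ∀ {W Z} (t : Hom W Z) (t∈ : In t) T p {n} c → n ≤ p →
      t ∘ req (advance t t∈ T (suc p) (n , c)) ≼ req (T (n , c))
    advance-old t t∈ T p {n} c n≤p with n ≟ suc p
    ... | yes refl = contradiction n≤p (1+n≰n)
    ... | no  _    = pullback-≼ t t∈ (T (n , c))

    record Extension {Y Z} (y : Hom Y Z) (r : Req Z) (B : Obj) : Set where
      field
        W     : Obj
        x     : Hom W Y
        x∈X   : X x
        yx≼r  : y ∘ x ≼ req r
        toB   : Hom W B
        toB∈  : In toB

    extend : ∀ {Y Z} (y : Hom Y Z) → X y → (r : Req Z) (B : Obj) → Extension y r B
    extend y y∈X (D , h , h∈) B with proj₂ X-dom y y∈X
    ... | _ , x₀ , x₀∈X , yx₀∈ with amalgamation (y ∘ x₀) h yx₀∈ h∈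
    ... | Y₂ , a , b , a∈ , b∈ , yx₀a≡hb with jointProj Y₂ B
    ... | W , p , q , p∈ , q∈ = record
      { W = W ; x = (x₀ ∘ a) ∘ p ; x∈X = proj₁ X-dom p (x₀ ∘ a) p∈ (proj₁ X-dom a x₀ a∈ x₀∈X)
      ; yx≼r = b ∘ p , ∘-In b∈ p∈ , factorisation ; toB = q ; toB∈ = q∈ }
      where
      open ≡-Reasoning
      factorisation : y ∘ ((x₀ ∘ a) ∘ p) ≡ h ∘ (b ∘ p)
      factorisation = begin
        y ∘ ((x₀ ∘ a) ∘ p)  ≡⟨ sym (assoc y (x₀ ∘ a) p) ⟩
        (y ∘ (x₀ ∘ a)) ∘ p  ≡⟨ cong (_∘ p) (sym (assoc y x₀ a)) ⟩
        ((y ∘ x₀) ∘ a) ∘ p  ≡⟨ cong (_∘ p) yx₀a≡hb ⟩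
        (h ∘ b) ∘ p         ≡⟨ assoc h b p ⟩
        h ∘ (b ∘ p)         ∎

    -- The state of the construction: the latest term y : Y → Z, and the
    -- positions and tables of Z and Y in their respective pair sequences.
    record Stage : Set where
      field
        Z Y  : Obj
        y    : Hom Y Z
        y∈X  : X y
        posZ posY : ℕ
        tabZ : Table Z
        tabY : Table Y

    module AtStage (S : Stage) where
      open Stage S

      ext : Extension y (tabZ (unpair posZ)) (fromMaybe Y (objEnum posZ))
      ext = extend y y∈X _ _

      open Extension ext public

      link∈ : In (y ∘ x)
      link∈ = ≼-In yx≼r (proj₂ (proj₂ (tabZ (unpair posZ))))

    open AtStage using (W; x; link∈)

    step : Stage → Stage
    step S = record
      { Z = Y ; Y = W S ; y = x S ; y∈X = AtStage.x∈X S
      ; posZ = posY ; posY = suc posZ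
      ; tabZ = tabY ; tabY = advance (y ∘ x S) (link∈ S) tabZ (suc posZ) }
      where open Stage S

    handledAt : ∀ S {i} → Stage.posZ S ≡ i → Stage.y S ∘ x S ≼ req (Stage.tabZ S (unpair i))
    handledAt S refl = AtStage.yx≼r S

    pulledAt : ∀ S {i} → Stage.posZ S ≡ i → ∀ {n} c → n ≤ i →
      (Stage.y S ∘ x S) ∘ req (Stage.tabY (step S) (n , c)) ≼ req (Stage.tabZ S (n , c))
    pulledAt S refl c n≤i = advance-old _ (link∈ S) (Stage.tabZ S) (Stage.posZ S) c n≤i

    freshAt : ∀ S {i} → Stage.posZ S ≡ i → ∀ {D} (f : Hom D (W S)) → In f →
      ∃[ c ] (req (Stage.tabY (step S) (suc i , c)) ≼ f)
    freshAt S refl f f∈ with enumReq-covers (W S) f f∈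
    ... | c , r≼f =
      c , subst (λ r → req r ≼ f) (sym (advance-fresh _ (link∈ S) (Stage.tabZ S) (suc (Stage.posZ S)) c)) r≼f

    ontoAt : ∀ S {i B} → Stage.posZ S ≡ i → objEnum i ≡ just B → Σ[ q ∈ Hom (W S) B ] In q
    ontoAt S refl listed =
      subst (λ B → Σ[ q ∈ Hom (W S) B ] In q) (cong (fromMaybe (Stage.Y S)) listed)
        (AtStage.toB S , AtStage.toB∈ S)

    onto : (T : ℕ → Stage) → (∀ i → Stage.posZ (T i) ≡ i) →
      ∀ c → Σ[ n ∈ ℕ ] Σ[ f ∈ Hom (W (T n)) c ] In f
    onto T at c with objEnum-onto c
    ... | n , B , listed , _ , φ⁻ , _ , φ⁻∈ , _ with ontoAt (T n) (at n) listed
    ... | q , q∈ = n , φ⁻ ∘ q , ∘-In φ⁻∈ q∈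

    initialTable : ∀ Z → Table Z
    initialTable Z (_ , c) = enumReq Z c

    module Run {A B} (g : Hom A B) (g∈X : X g) where

      stage : ℕ → Stage
      stage zero = record
        { Z = B ; Y = A ; y = g ; y∈X = g∈X
        ; posZ = 0 ; posY = 0 ; tabZ = initialTable B ; tabY = initialTable A }
      stage (suc l) = step (stage l)

      o : ℕ → Obj
      o l = Stage.Z (stage l)

      s : ∀ l → Hom (o (suc l)) (o l)
      s l = Stage.y (stage l)

      at-even : ∀ i → Stage.posZ (stage (double 𝓕 i)) ≡ i
      at-even zero    = refl
      at-even (suc i) = cong suc (at-even i)

      at-odd : ∀ i → Stage.posZ (stage (suc (double 𝓕 i))) ≡ i
      at-odd zero    = refl
      at-odd (suc i) = cong suc (at-odd i)

      even-generic : Generic 𝓕 (evenObj 𝓕 o) (evenSeq 𝓕 o s)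
      even-generic =
        bookkeeping⇒generic _ _ (λ i → link∈ (stage (double 𝓕 i))) (onto (λ i → stage (double 𝓕 i)) at-even)
          record { table = λ i → Stage.tabZ (stage (double 𝓕 i)) ; fresh = fresh
                 ; pulled = λ i n c → pulledAt (stage (double 𝓕 i)) (at-even i) c
                 ; handled = λ i → handledAt (stage (double 𝓕 i)) (at-even i) }
        where
        fresh : ∀ i {D} (f : Hom D (evenObj 𝓕 o i)) → In f →
          ∃[ c ] (req (Stage.tabZ (stage (double 𝓕 i)) (i , c)) ≼ f)
        fresh zero    = enumReq-covers B
        fresh (suc i) = freshAt (stage (double 𝓕 i)) (at-even i)

      odd-generic : Generic 𝓕 (oddObj 𝓕 o) (oddSeq 𝓕 o s)
      odd-generic =
        bookkeeping⇒generic _ _ (λ i → link∈ (stage (suc (double 𝓕 i)))) (onto (λ i → stage (suc (double 𝓕 i))) at-odd)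
          record { table = λ i → Stage.tabZ (stage (suc (double 𝓕 i))) ; fresh = fresh
                 ; pulled = λ i n c → pulledAt (stage (suc (double 𝓕 i))) (at-odd i) c
                 ; handled = λ i → handledAt (stage (suc (double 𝓕 i))) (at-odd i) }
        where
        fresh : ∀ i {D} (f : Hom D (oddObj 𝓕 o i)) → In f →
          ∃[ c ] (req (Stage.tabZ (stage (suc (double 𝓕 i))) (i , c)) ≼ f)
        fresh zero    = enumReq-covers A
        fresh (suc i) = freshAt (stage (suc (double 𝓕 i))) (at-odd i)

  forward : ProjectiveFraisse 𝓕 → ∀ {A B} (g : Hom A B) → InClosure 𝓕 g → HasIsoSequenceFrom 𝓕 g
  forward PF g (X , X-dom , g∈X) = o , s , (even-generic , odd-generic) , refl
    where open Forward.Run PF X X-dom g g∈X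

theorem4p7 : (𝓔 : Category) (𝓕 : Subcategory 𝓔) → ProjectiveFraisse 𝓕 →
    ∀ {A B} (g : Category.Hom 𝓔 A B) →
      (InClosure 𝓕 g → HasIsoSequenceFrom 𝓕 g) × (HasIsoSequenceFrom 𝓕 g → InClosure 𝓕 g)
theorem4p7 𝓔 𝓕 PF g = forward 𝓕 PF g , backward 𝓕 g
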